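{- Let $D$ be a reduced complete structured DNNF and let $g$ be a gate in $D$. Let $a_g$ be an assignment to $\mathsf{var}(g)$, the variables in the subcircuit rooted in $g$, that satisfies $g$. Then $a_g$ can be extended to an assignment $a$ to all variables of $D$ that satisfies $D$.
   Context: A v-tree for a finite variable set $X$ is a full binary rooted tree whose leaves are in bijection with $X$. A complete structured DNNF $D$ structured by a v-tree $T$ is a Boolean circuit whose input gates are literals $x$ or $\neg x$ (no constants), whose $\land$-gates have exactly two inputs and whose $\lor$-gates have arbitrary fan-in, together with a labeling $\mu$ of nodes of $T$ by sets of gates such that: every gate $g$ lies in $\mu(t_g)$ for a unique node $t_g$; if $t$ is a leaf labelled $x$ then $\mu(t)\subseteq\{x,\neg x\}$, and every input gate lies in $\mu$ of a leaf; every input of an $\lor$-gate $g$ is an $\land$-gate in $\mu(t_g)$; every $\land$-gate $g$ has two inputs $g_1,g_2$, each an $\lor$-gate or input gate, with $t_{g_1},t_{g_2}$ the two children of $t_g$. It is reduced if from every gate there is a directed path to the output gate. -}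

module Defs where

open import Data.Nat using (ℕ)
open import Data.Fin using (Fin)
open import Data.Bool using (Bool)
open import Data.Maybe using (Maybe; just; nothing)
open import Data.List using (List; [])
open import Data.List.Membership.Propositional using (_∈_)
open import Data.Product using (Σ; ∃; _×_)
open import Data.Sum using (_⊎_)
open import Relation.Binary.PropositionalEquality using (_≡_; _≢_)
open import Relation.Binary.Construct.Closure.ReflexiveTransitive using (Star)

data VTree (n : ℕ) : Set where
  leaf : Fin n → VTree n
  node : VTree n → VTree n → VTree n

-- nodes of a v-tree, given as positions (paths from the root)
data Pos {n : ℕ} : VTree n → Set where
  here  : ∀ {t} → Pos t
  left  : ∀ {l r} → Pos l → Pos (node l r)
  right : ∀ {l r} → Pos r → Pos (node l r)

subtree : ∀ {n} {t : VTree n} → Pos t → VTree n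
subtree {t = t} here = t
subtree (left p)     = subtree p
subtree (right p)    = subtree p

data LeftChild {n : ℕ} : {t : VTree n} → Pos t → Pos t → Set where
  base : ∀ {l r} → LeftChild {t = node l r} (left here) here
  inL  : ∀ {l r} {p q : Pos l} → LeftChild p q → LeftChild {t = node l r} (left p) (left q)
  inR  : ∀ {l r} {p q : Pos r} → LeftChild p q → LeftChild {t = node l r} (right p) (right q)

data RightChild {n : ℕ} : {t : VTree n} → Pos t → Pos t → Set where
  base : ∀ {l r} → RightChild {t = node l r} (right here) here
  inL  : ∀ {l r} {p q : Pos l} → RightChild p q → RightChild {t = node l r} (left p) (left q)
  inR  : ∀ {l r} {p q : Pos r} → RightChild p q → RightChild {t = node l r} (right p) (right q)

Children : ∀ {n} {t : VTree n} → Pos t → Pos t → Pos t → Set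
Children p q₁ q₂ = (LeftChild q₁ p × RightChild q₂ p) ⊎ (RightChild q₁ p × LeftChild q₂ p)

-- T is a v-tree for Fin n: leaves are in bijection with the variables
-- (every variable labels exactly one leaf; every leaf carries a label)
IsVTree : ∀ {n} → VTree n → Set
IsVTree {n} T = (x : Fin n) → Σ (Pos T) λ p → subtree p ≡ leaf x × ((q : Pos T) → subtree q ≡ leaf x → q ≡ p)

-- lit x true is the literal x, lit x false is the literal ¬x
data Gate (n m : ℕ) : Set where
  lit : Fin n → Bool → Gate n m
  and : Fin m → Fin m → Gate n m
  or  : List (Fin m) → Gate n m

record Circuit (n m : ℕ) : Set where
  field
    gate   : Fin m → Gate n m
    output : Fin m
open Circuit public

data IsAnd {n m : ℕ} : Gate n m → Set where
  is-and : ∀ g₁ g₂ → IsAnd (and g₁ g₂)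

data IsOrOrInput {n m : ℕ} : Gate n m → Set where
  is-or  : ∀ hs → IsOrOrInput (or hs)
  is-lit : ∀ x b → IsOrOrInput (lit x b)

data Input {n m : ℕ} (D : Circuit n m) : Fin m → Fin m → Set where
  and₁ : ∀ {g g₁ g₂} → gate D g ≡ and g₁ g₂ → Input D g₁ g
  and₂ : ∀ {g g₁ g₂} → gate D g ≡ and g₁ g₂ → Input D g₂ g
  or-in : ∀ {g hs h} → gate D g ≡ or hs → h ∈ hs → Input D h g

Path : ∀ {n m} → Circuit n m → Fin m → Fin m → Set
Path D = Star (Input D)

VarOf : ∀ {n m} → Circuit n m → Fin m → Fin n → Set
VarOf D g x = ∃ λ l → ∃ λ b → gate D l ≡ lit x b × Path D l g

Reduced : ∀ {n m} → Circuit n m → Set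
Reduced {m = m} D = (h : Fin m) → Path D h (output D)

-- D is a complete structured DNNF structured by the v-tree T;
-- node-of g is the unique node t_g with g ∈ μ(t_g)
record Structured {n m : ℕ} (D : Circuit n m) (T : VTree n) : Set where
  field
    node-of    : Fin m → Pos T
    lit-leaf   : ∀ g x b → gate D g ≡ lit x b → subtree (node-of g) ≡ leaf x
    leaf-lit   : ∀ g x → subtree (node-of g) ≡ leaf x → ∃ λ b → gate D g ≡ lit x b
    lit-unique : ∀ g h x b → gate D g ≡ lit x b → gate D h ≡ lit x b → g ≡ h
    -- ∨-gates have at least one input (no constants)
    or-nonempty : ∀ g hs → gate D g ≡ or hs → hs ≢ []
    or-inputs  : ∀ g hs h → gate D g ≡ or hs → h ∈ hs →
                 IsAnd (gate D h) × node-of h ≡ node-of g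
    and-inputs : ∀ g g₁ g₂ → gate D g ≡ and g₁ g₂ →
                 IsOrOrInput (gate D g₁) × IsOrOrInput (gate D g₂) ×
                 Children (node-of g) (node-of g₁) (node-of g₂)

-- Semantics under a (partial) assignment ρ : Fin n → Maybe Bool.
-- Since structured circuits are acyclic, the inductive predicate below
-- coincides with "g evaluates to true".

data Sat {n m : ℕ} (D : Circuit n m) (ρ : Fin n → Maybe Bool) : Fin m → Set where
  sat-lit : ∀ {g x b} → gate D g ≡ lit x b → ρ x ≡ just b → Sat D ρ g
  sat-and : ∀ {g g₁ g₂} → gate D g ≡ and g₁ g₂ → Sat D ρ g₁ → Sat D ρ g₂ → Sat D ρ g
  sat-or  : ∀ {g hs h} → gate D g ≡ or hs → h ∈ hs → Sat D ρ h → Sat D ρ g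

AssignmentTo : ∀ {n m} → Circuit n m → Fin m → (Fin n → Maybe Bool) → Set
AssignmentTo {n} D g ρ =
  (x : Fin n) → (VarOf D g x → ∃ λ b → ρ x ≡ just b) × (∀ b → ρ x ≡ just b → VarOf D g x)

Extends : ∀ {n} → (Fin n → Maybe Bool) → (Fin n → Bool) → Set
Extends {n} ρ a = (x : Fin n) (b : Bool) → ρ x ≡ just b → a x ≡ b

module Submission where

-- Order the nodes of the v-tree by "p ≼ q: p lies in the
-- subtree of q".  In a structured DNNF every gate h only reads variables
-- whose leaves lie below its node t_h, and the two inputs of an ∧-gate sit
-- at the two children of its node, whose subtrees are disjoint.  Hence
--   * locality: whether a total assignment satisfies h depends only on its
--     values at variables below t_h;
--   * every gate is satisfiable (induction on the size of the subtree at
--     t_h; ∨-gates are nonempty, so no constant false gates exist);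
--   * if h feeds a gate g, any assignment a satisfying h can be changed
--     outside t_h (using a satisfying assignment of the sibling of h) so that
--     it satisfies g.
-- Iterating the last step along the path from g to the output, given by
-- reducedness, turns a total completion of a_g into an assignment that
-- satisfies D and still agrees with a_g on var(g), since var(g) lies below t_g.

open import Defs
open import Data.Fin using (Fin)
open import Data.Bool using (Bool; false; if_then_else_)
open import Data.Maybe using (Maybe; just; fromMaybe)
open import Data.Product using (Σ; _×_; _,_; proj₁; proj₂)
import Data.Product as Product
open import Data.Sum using (_⊎_; inj₁; inj₂)
import Data.Sum as Sum
open import Data.List using ([]; _∷_)
open import Data.List.Relation.Unary.Any using (here)
open import Data.Nat using (ℕ; suc; _+_; _<_; s≤s)
open import Data.Nat.Properties using (m≤m+n; m≤n+m)
open import Data.Nat.Induction using (<-wellFounded)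
open import Data.Empty using (⊥; ⊥-elim)
open import Relation.Nullary using (Dec; yes; no; ¬_)
open import Relation.Nullary.Decidable using (map′; ⌊_⌋)
open import Relation.Binary.PropositionalEquality using (_≡_; refl; sym; trans; cong; subst)
open import Relation.Binary.Construct.Closure.ReflexiveTransitive using (ε; _◅_)
open import Relation.Binary.Construct.On using () renaming (wellFounded to on-wellFounded)
open import Induction.WellFounded using (Acc; acc; WellFounded)
open import Function using (_∘_; _on_)

data _≼_ {n : ℕ} : {t : VTree n} → Pos t → Pos t → Set where
  ≼-here  : ∀ {t} {p : Pos t} → p ≼ here
  ≼-left  : ∀ {l r} {p q : Pos l} → p ≼ q → _≼_ {t = node l r} (left p) (left q)
  ≼-right : ∀ {l r} {p q : Pos r} → p ≼ q → _≼_ {t = node l r} (right p) (right q)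

≼-refl : ∀ {n} {t : VTree n} {p : Pos t} → p ≼ p
≼-refl {p = here}    = ≼-here
≼-refl {p = left p}  = ≼-left ≼-refl
≼-refl {p = right p} = ≼-right ≼-refl

≼-trans : ∀ {n} {t : VTree n} {p q r : Pos t} → p ≼ q → q ≼ r → p ≼ r
≼-trans _           ≼-here      = ≼-here
≼-trans (≼-left a)  (≼-left b)  = ≼-left (≼-trans a b)
≼-trans (≼-right a) (≼-right b) = ≼-right (≼-trans a b)

-- decidability is needed to splice two assignments along a subtree
_≼?_ : ∀ {n} {t : VTree n} (p q : Pos t) → Dec (p ≼ q)
p       ≼? here    = yes ≼-here
here    ≼? left q  = no λ ()
here    ≼? right q = no λ ()
left p  ≼? left q  = map′ ≼-left (λ { (≼-left a) → a }) (p ≼? q)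
left p  ≼? right q = no λ ()
right p ≼? left q  = no λ ()
right p ≼? right q = map′ ≼-right (λ { (≼-right a) → a }) (p ≼? q)

leftChild-≼ : ∀ {n} {t : VTree n} {q p : Pos t} → LeftChild q p → q ≼ p
leftChild-≼ base    = ≼-here
leftChild-≼ (inL c) = ≼-left (leftChild-≼ c)
leftChild-≼ (inR c) = ≼-right (leftChild-≼ c)

rightChild-≼ : ∀ {n} {t : VTree n} {q p : Pos t} → RightChild q p → q ≼ p
rightChild-≼ base    = ≼-here
rightChild-≼ (inL c) = ≼-left (rightChild-≼ c)
rightChild-≼ (inR c) = ≼-right (rightChild-≼ c)

children-≼ : ∀ {n} {t : VTree n} {p q₁ q₂ : Pos t} → Children p q₁ q₂ → q₁ ≼ p × q₂ ≼ p
children-≼ (inj₁ (c₁ , c₂)) = leftChild-≼ c₁ , rightChild-≼ c₂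
children-≼ (inj₂ (c₁ , c₂)) = rightChild-≼ c₁ , leftChild-≼ c₂

children-swap : ∀ {n} {t : VTree n} {p q₁ q₂ : Pos t} → Children p q₁ q₂ → Children p q₂ q₁
children-swap = Sum.swap ∘ Sum.map Product.swap Product.swap

leftRight-disjoint : ∀ {n} {t : VTree n} {x q₁ q₂ p : Pos t} →
                     LeftChild q₁ p → RightChild q₂ p → x ≼ q₁ → x ≼ q₂ → ⊥
leftRight-disjoint base    base    (≼-left _)  ()
leftRight-disjoint (inL c) (inL d) (≼-left a)  (≼-left b)  = leftRight-disjoint c d a b
leftRight-disjoint (inR c) (inR d) (≼-right a) (≼-right b) = leftRight-disjoint c d a b

children-disjoint : ∀ {n} {t : VTree n} {x p q₁ q₂ : Pos t} →
                    Children p q₁ q₂ → x ≼ q₁ → x ≼ q₂ → ⊥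
children-disjoint (inj₁ (c₁ , c₂)) a b = leftRight-disjoint c₁ c₂ a b
children-disjoint (inj₂ (c₁ , c₂)) a b = leftRight-disjoint c₂ c₁ b a

size : ∀ {n} → VTree n → ℕ
size (leaf _)   = 1
size (node l r) = suc (size l + size r)

_⊏_ : ∀ {n} {t : VTree n} → Pos t → Pos t → Set
_⊏_ = _<_ on (size ∘ subtree)

⊏-wellFounded : ∀ {n} {t : VTree n} → WellFounded (_⊏_ {t = t})
⊏-wellFounded = on-wellFounded (size ∘ subtree) <-wellFounded

leftChild-⊏ : ∀ {n} {t : VTree n} {q p : Pos t} → LeftChild q p → q ⊏ p
leftChild-⊏ (base {l} {r}) = s≤s (m≤m+n (size l) (size r))
leftChild-⊏ (inL c)        = leftChild-⊏ c
leftChild-⊏ (inR c)        = leftChild-⊏ c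

rightChild-⊏ : ∀ {n} {t : VTree n} {q p : Pos t} → RightChild q p → q ⊏ p
rightChild-⊏ (base {l} {r}) = s≤s (m≤n+m (size r) (size l))
rightChild-⊏ (inL c)        = rightChild-⊏ c
rightChild-⊏ (inR c)        = rightChild-⊏ c

children-⊏ : ∀ {n} {t : VTree n} {p q₁ q₂ : Pos t} → Children p q₁ q₂ → q₁ ⊏ p × q₂ ⊏ p
children-⊏ (inj₁ (c₁ , c₂)) = leftChild-⊏ c₁ , rightChild-⊏ c₂
children-⊏ (inj₂ (c₁ , c₂)) = rightChild-⊏ c₁ , leftChild-⊏ c₂

complete : ∀ {n} → (Fin n → Maybe Bool) → Fin n → Bool
complete ρ = fromMaybe false ∘ ρ

complete-extends : ∀ {n} (ρ : Fin n → Maybe Bool) → Extends ρ (complete ρ)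
complete-extends ρ x b ρx≡b rewrite ρx≡b = refl

sat-extends : ∀ {n m} {D : Circuit n m} {ρ a g} → Extends ρ a → Sat D ρ g → Sat D (just ∘ a) g
sat-extends ext (sat-lit {x = x} eq ρx≡b) = sat-lit eq (cong just (ext x _ ρx≡b))
sat-extends ext (sat-and eq s₁ s₂)        = sat-and eq (sat-extends ext s₁) (sat-extends ext s₂)
sat-extends ext (sat-or eq mem s)         = sat-or eq mem (sat-extends ext s)

module StructuredDNNF {n m} (T : VTree n) (vt : IsVTree T)
                      (D : Circuit n m) (S : Structured D T) where
  open Structured S

  leafOf : Fin n → Pos T
  leafOf x = proj₁ (vt x)

  Agree : (Fin n → Bool) → (Fin n → Bool) → Pos T → Set
  Agree a a′ p = ∀ x → leafOf x ≼ p → a x ≡ a′ x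

  agree-trans : ∀ {a b c p} → Agree a b p → Agree b c p → Agree a c p
  agree-trans ab bc x below = trans (ab x below) (bc x below)

  agree-mono : ∀ {a b p q} → q ≼ p → Agree a b p → Agree a b q
  agree-mono q≼p ab x below = ab x (≼-trans below q≼p)

  lit-node : ∀ {l x b} → gate D l ≡ lit x b → leafOf x ≼ node-of l
  lit-node {l} {x} {b} eq =
    subst (_≼ node-of l) (proj₂ (proj₂ (vt x)) (node-of l) (lit-leaf l x b eq)) ≼-refl

  Conjuncts : Fin m → Fin m → Fin m → Set
  Conjuncts g h h′ = gate D g ≡ and h h′ ⊎ gate D g ≡ and h′ h

  conjuncts-children : ∀ {g h h′} → Conjuncts g h h′ → Children (node-of g) (node-of h) (node-of h′)
  conjuncts-children {g} {h} {h′} (inj₁ eq) = proj₂ (proj₂ (and-inputs g h h′ eq))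
  conjuncts-children {g} {h} {h′} (inj₂ eq) = children-swap (proj₂ (proj₂ (and-inputs g h′ h eq)))

  -- wires go from a node to itself or to its parent, so paths go upwards
  input-≼ : ∀ {h g} → Input D h g → node-of h ≼ node-of g
  input-≼ (and₁ eq) = proj₁ (children-≼ (conjuncts-children (inj₁ eq)))
  input-≼ (and₂ eq) = proj₁ (children-≼ (conjuncts-children (inj₂ eq)))
  input-≼ (or-in {g} {hs} {h} eq mem) = subst (node-of h ≼_) (proj₂ (or-inputs g hs h eq mem)) ≼-refl

  path-≼ : ∀ {h g} → Path D h g → node-of h ≼ node-of g
  path-≼ ε       = ≼-refl
  path-≼ (i ◅ p) = ≼-trans (input-≼ i) (path-≼ p)

  var-≼ : ∀ {g x} → VarOf D g x → leafOf x ≼ node-of g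
  var-≼ (l , b , eq , path) = ≼-trans (lit-node eq) (path-≼ path)

  sat-local : ∀ {a a′ h} → Sat D (just ∘ a) h → Agree a a′ (node-of h) → Sat D (just ∘ a′) h
  sat-local (sat-lit {x = x} eq ax≡b) agree =
    sat-lit eq (trans (cong just (sym (agree x (lit-node eq)))) ax≡b)
  sat-local (sat-and eq s₁ s₂) agree =
    let below₁ , below₂ = children-≼ (conjuncts-children (inj₁ eq)) in
    sat-and eq (sat-local s₁ (agree-mono below₁ agree)) (sat-local s₂ (agree-mono below₂ agree))
  sat-local (sat-or {g} {hs} {h} eq mem s) agree =
    sat-or eq mem (sat-local s (subst (Agree _ _) (sym (proj₂ (or-inputs g hs h eq mem))) agree))

  override : Pos T → (Fin n → Bool) → (Fin n → Bool) → Fin n → Bool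
  override p a b x = if ⌊ leafOf x ≼? p ⌋ then b x else a x

  override-inside : ∀ {p} a b {x} → leafOf x ≼ p → override p a b x ≡ b x
  override-inside {p} a b {x} inside with leafOf x ≼? p
  ... | yes _     = refl
  ... | no ¬inside = ⊥-elim (¬inside inside)

  override-outside : ∀ {p} a b {x} → ¬ leafOf x ≼ p → override p a b x ≡ a x
  override-outside {p} a b {x} outside with leafOf x ≼? p
  ... | yes inside = ⊥-elim (outside inside)
  ... | no _       = refl

  override-sibling : ∀ {g h h′} a b → Conjuncts g h h′ → Agree a (override (node-of h′) a b) (node-of h)
  override-sibling a b c x below =
    sym (override-outside a b (children-disjoint (conjuncts-children c) below))

  override-sat : ∀ {g h h′ a b} → Conjuncts g h h′ →
                 Sat D (just ∘ a) h → Sat D (just ∘ b) h′ → Sat D (just ∘ override (node-of h′) a b) g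
  override-sat {a = a} {b} c sa sb with sat-local sa (override-sibling a b c)
                                      | sat-local sb (λ x below → sym (override-inside a b below))
  override-sat (inj₁ eq) _ _ | sa′ | sb′ = sat-and eq sa′ sb′
  override-sat (inj₂ eq) _ _ | sa′ | sb′ = sat-and eq sb′ sa′

  Satisfiable : Fin m → Set
  Satisfiable h = Σ (Fin n → Bool) λ a → Sat D (just ∘ a) h

  satisfiable-at : ∀ {p} → Acc _⊏_ p → ∀ h → node-of h ≡ p → Satisfiable h
  satisfiable-and : ∀ {p} → Acc _⊏_ p → ∀ {h g₁ g₂} → gate D h ≡ and g₁ g₂ → node-of h ≡ p → Satisfiable h

  satisfiable-and (acc smaller) {h} {g₁} {g₂} eq refl =
    let ⊏₁ , ⊏₂ = children-⊏ (conjuncts-children (inj₁ eq))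
        a₁ , s₁ = satisfiable-at (smaller ⊏₁) g₁ refl
        a₂ , s₂ = satisfiable-at (smaller ⊏₂) g₂ refl
    in override (node-of g₂) a₁ a₂ , override-sat (inj₁ eq) s₁ s₂

  satisfiable-at rec h h≡p with gate D h in eq
  ... | lit x b     = (λ _ → b) , sat-lit eq refl
  ... | and g₁ g₂   = satisfiable-and rec eq h≡p
  ... | or []       = ⊥-elim (or-nonempty h [] eq refl)
  ... | or (h′ ∷ hs) with or-inputs h (h′ ∷ hs) h′ eq (here refl)
  ...   | is-and-h′ , same with gate D h′ in eq′ | is-and-h′
  ...     | and g₁ g₂ | is-and g₁ g₂ =
    let a , s = satisfiable-and rec eq′ (trans same h≡p) in a , sat-or eq (here refl) s

  satisfiable : ∀ h → Satisfiable h
  satisfiable h = satisfiable-at (⊏-wellFounded (node-of h)) h refl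

  Extension : (Fin n → Bool) → Fin m → Fin m → Set
  Extension a h g = Σ (Fin n → Bool) λ a′ → Agree a a′ (node-of h) × Sat D (just ∘ a′) g

  extend-input : ∀ {h g a} → Input D h g → Sat D (just ∘ a) h → Extension a h g
  extend-input {a = a} (and₁ eq) s =
    let b , sb = satisfiable _ in override _ a b , override-sibling a b (inj₁ eq) , override-sat (inj₁ eq) s sb
  extend-input {a = a} (and₂ eq) s =
    let b , sb = satisfiable _ in override _ a b , override-sibling a b (inj₂ eq) , override-sat (inj₂ eq) s sb
  extend-input {a = a} (or-in eq mem) s = a , (λ _ _ → refl) , sat-or eq mem s

  extend-path : ∀ {h g a} → Path D h g → Sat D (just ∘ a) h → Extension a h g
  extend-path {a = a} ε s = a , (λ _ _ → refl) , s
  extend-path (i ◅ path) s =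
    let a₁ , agree₁ , s₁ = extend-input i s
        a₂ , agree₂ , s₂ = extend-path path s₁
    in a₂ , agree-trans agree₁ (agree-mono (input-≼ i) agree₂) , s₂

lemma4 : ∀ {n m} (T : VTree n) → IsVTree T →
         (D : Circuit n m) → Structured D T → Reduced D →
         (g : Fin m) (ag : Fin n → Maybe Bool) →
         AssignmentTo D g ag → Sat D ag g →
         Σ (Fin n → Bool) λ a → Extends ag a × Sat D (just ∘ a) (output D)
lemma4 T vt D S reduced g ag domain sat =
  let a , agree , sat-out = extend-path (reduced g) (sat-extends (complete-extends ag) sat)
  in a , extends agree , sat-out
  where
  open StructuredDNNF T vt D S

  -- a agrees with the completion of ag below t_g, which contains var(g) = dom(ag)
  extends : ∀ {a} → Agree (complete ag) a (Structured.node-of S g) → Extends ag a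
  extends agree x b ag-x≡b =
    trans (sym (agree x (var-≼ (proj₂ (domain x) b ag-x≡b)))) (complete-extends ag x b ag-x≡b)
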